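{- If $\mathcal{A}_1$ is an NFW with $n$ states, then there is a full NFW $\mathcal{A}_2$ with $n$ states such that $C_{\mathrm{NFW}}(\mathcal{A}_2)\geq C_{\mathrm{NFW}}(\mathcal{A}_1)$.
   Context: An NFW is $\mathcal{A}=(\Sigma,S,I,\Delta,F)$ with finite alphabet $\Sigma$, finite state set $S$, initial states $I\subseteq S$, transition relation $\Delta\subseteq S\times\Sigma\times S$ and final states $F\subseteq S$; a finite word $a(0)\cdots a(l-1)$ is accepted if there is a state sequence $\rho(0)\cdots\rho(l)$ with $\rho(0)\in I$, $\rho(l)\in F$ and $\langle\rho(i),a(i),\rho(i+1)\rangle\in\Delta$ for all $i<l$; $\mathcal{L}(\mathcal{A})$ is the set of accepted words. $C_{\mathrm{NFW}}(\mathcal{A})$ is the minimum number of states of an NFW over $\Sigma$ accepting $\Sigma^*\setminus\mathcal{L}(\mathcal{A})$. A full NFW is one of the form $(\Sigma,S,I,\Delta,F)$ with $S$ finite, $I,F\subseteq S$ arbitrary, $\Sigma=\mathcal{P}(S\times S)$, and $\langle p,a,q\rangle\in\Delta$ iff $\langle p,q\rangle\in a$. -}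

module Defs where

open import Data.Nat using (ℕ; _≤_)
open import Data.Fin using (Fin)
open import Data.Bool using (Bool; true)
open import Data.List using (List; []; _∷_)
open import Data.Vec using (Vec; lookup)
open import Data.Product using (Σ; ∃; _×_)
open import Relation.Binary.PropositionalEquality using (_≡_)
open import Relation.Nullary using (¬_)
open import Function.Bundles using (_⇔_)

-- An NFW over alphabet Σ' with state set Fin n (any finite state set is
-- isomorphic to some Fin n).  Initial/final sets and the transition relation
-- are given by their characteristic functions.
record NFW (Σ' : Set) (n : ℕ) : Set where
  field
    I : Fin n → Bool
    Δ : Fin n → Σ' → Fin n → Bool
    F : Fin n → Bool
open NFW public

data Path {Σ' : Set} {n : ℕ} (A : NFW Σ' n) : Fin n → List Σ' → Fin n → Set where
  nil  : ∀ {p} → Path A p [] p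
  cons : ∀ {p a q w r} → Δ A p a q ≡ true → Path A q w r → Path A p (a ∷ w) r

Accepts : {Σ' : Set} {n : ℕ} → NFW Σ' n → List Σ' → Set
Accepts A w = ∃ λ p → ∃ λ q → I A p ≡ true × F A q ≡ true × Path A p w q

Complements : {Σ' : Set} {n m : ℕ} → NFW Σ' n → NFW Σ' m → Set
Complements A B = ∀ w → Accepts B w ⇔ (¬ Accepts A w)

-- C_NFW(A) ≤ m : some NFW over the same alphabet with at most m states
-- accepts the complement of L(A).
CompSize≤ : {Σ' : Set} {n : ℕ} → NFW Σ' n → ℕ → Set
CompSize≤ {Σ'} A m = ∃ λ m' → m' ≤ m × Σ (NFW Σ' m') λ B → Complements A B

-- Subsets of S × S (S = Fin n) as n×n Boolean matrices: the alphabet of a full NFW.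
Letter : ℕ → Set
Letter n = Vec (Vec Bool n) n

-- The full NFW on Fin n with given initial and final sets:
-- ⟨p,a,q⟩ ∈ Δ iff ⟨p,q⟩ ∈ a.
Full : (n : ℕ) → (Fin n → Bool) → (Fin n → Bool) → NFW (Letter n) n
Full n I' F' = record { I = I' ; Δ = λ p a q → lookup (lookup a p) q ; F = F' }

module Submission where

-- Every NFW A over Fin k with states Fin n is a "relabelling"
-- of the full NFW with the same initial and final sets: the letter σ is
-- sent to the matrix encode σ whose (p , q) entry is Δ A p σ q, so A reads
-- w exactly as the full automaton reads map encode w.  Conversely, any NFW
-- B over the full alphabet can be pulled back along encode to an NFW over
-- Fin k with the same states; its language is the preimage of L(B).
-- Preimages commute with complements, so if B accepts the complement of
-- the full automaton's language then the pullback of B accepts the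
-- complement of L(A).

open import Defs
open import Data.Nat using (ℕ)
open import Data.Fin using (Fin)
open import Data.Bool using (Bool)
open import Data.Product using (∃; ∃₂; _,_)
open import Data.List using ([]; _∷_; map)
open import Data.Vec using (tabulate; lookup)
open import Data.Vec.Properties using (lookup∘tabulate)
open import Relation.Binary.PropositionalEquality using (_≡_; refl; trans; sym)
open import Function.Bundles using (_⇔_; mk⇔; Equivalence)

record Relabelling {Σ Γ : Set} {n : ℕ} (h : Σ → Γ)
                   (A : NFW Σ n) (B : NFW Γ n) : Set where
  field
    initial     : ∀ p → I B p ≡ I A p
    transitions : ∀ p a q → Δ B p (h a) q ≡ Δ A p a q
    final       : ∀ q → F B q ≡ F A q

module _ {Σ Γ : Set} {n : ℕ} {h : Σ → Γ} {A : NFW Σ n} {B : NFW Γ n}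
         (ρ : Relabelling h A B) where
  open Relabelling ρ

  path-relabel : ∀ {p w q} → Path A p w q → Path B p (map h w) q
  path-relabel nil = nil
  path-relabel (cons {p} {a} {q} step run) =
    cons (trans (transitions p a q) step) (path-relabel run)

  path-unrelabel : ∀ {p w q} → Path B p (map h w) q → Path A p w q
  path-unrelabel {w = []}    nil = nil
  path-unrelabel {p} {w = a ∷ w} (cons {q = q} step run) =
    cons (trans (sym (transitions p a q)) step) (path-unrelabel run)

  accepts-relabel : ∀ w → Accepts A w ⇔ Accepts B (map h w)
  accepts-relabel w = mk⇔
    (λ { (p , q , i , f , run) →
           p , q , trans (initial p) i , trans (final q) f , path-relabel run })
    (λ { (p , q , i , f , run) →
           p , q , trans (sym (initial p)) i , trans (sym (final q)) f
             , path-unrelabel run })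

pullback : {Σ Γ : Set} {m : ℕ} → (Σ → Γ) → NFW Γ m → NFW Σ m
pullback h B = record { I = I B ; Δ = λ p a q → Δ B p (h a) q ; F = F B }

pullback-relabelling : {Σ Γ : Set} {m : ℕ} (h : Σ → Γ) (B : NFW Γ m) →
  Relabelling h (pullback h B) B
pullback-relabelling h B = record
  { initial = λ _ → refl ; transitions = λ _ _ _ → refl ; final = λ _ → refl }

-- Preimages commute with complements: if B recognises the complement of
-- L(A'), and A is a relabelling of A', then pulling B back recognises the
-- complement of L(A).
complements-pullback : {Σ Γ : Set} {n m : ℕ} {h : Σ → Γ}
  {A : NFW Σ n} {A' : NFW Γ n} {B : NFW Γ m} →
  Relabelling h A A' → Complements A' B → Complements A (pullback h B)
complements-pullback {h = h} {B = B} ρ co w = mk⇔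
  (λ accB accA → to (co (map h w)) (to (pullback-accepts w) accB)
                                   (to (accepts-relabel ρ w) accA))
  (λ rejA → from (pullback-accepts w)
              (from (co (map h w)) (λ accA' → rejA (from (accepts-relabel ρ w) accA'))))
  where
    open Equivalence
    pullback-accepts = accepts-relabel (pullback-relabelling h B)

compSize-relabel : {Σ Γ : Set} {n : ℕ} {h : Σ → Γ}
  {A : NFW Σ n} {A' : NFW Γ n} → Relabelling h A A' →
  (m : ℕ) → CompSize≤ A' m → CompSize≤ A m
compSize-relabel {h = h} ρ m (m' , m'≤m , B , co) =
  m' , m'≤m , pullback h B , complements-pullback ρ co

encode : {k n : ℕ} → NFW (Fin k) n → Fin k → Letter n
encode A σ = tabulate λ p → tabulate λ q → Δ A p σ q

full-relabelling : {k n : ℕ} (A : NFW (Fin k) n) →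
  Relabelling (encode A) A (Full n (I A) (F A))
full-relabelling A = record
  { initial     = λ _ → refl
  ; transitions = entry
  ; final       = λ _ → refl
  }
  where
    entry : ∀ p σ q → lookup (lookup (encode A σ) p) q ≡ Δ A p σ q
    entry p σ q rewrite lookup∘tabulate (λ p → tabulate λ q → Δ A p σ q) p =
      lookup∘tabulate (λ q → Δ A p σ q) q

lemma3p4 : (k n : ℕ) (A₁ : NFW (Fin k) n) →
    ∃₂ λ (I₂ F₂ : Fin n → Bool) →
    (m : ℕ) → CompSize≤ (Full n I₂ F₂) m → CompSize≤ A₁ m
lemma3p4 k n A₁ = I A₁ , F A₁ , compSize-relabel (full-relabelling A₁)
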